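{- Let $\Gamma$ be an LDDG with parameters $(v,k,\lambda_1,\lambda_2,m,n)$. Then $k(k-1) = (n-1)\lambda_1 + (m-1)n\lambda_2$.
   Context: Graphs here are finite, undirected, without multiple edges, but loops are allowed: a vertex may be adjacent to itself. For a vertex $x$, $\Gamma(x)$ is the set of vertices adjacent to $x$ (containing $x$ iff $x$ has a loop), and the degree of $x$ is $|\Gamma(x)|$ (a loop contributes exactly 1). Common neighbours of $x,y$ are the elements of $\Gamma(x)\cap\Gamma(y)$. A $k$-regular graph on $v$ vertices is an LDDG with parameters $(v,k,\lambda_1,\lambda_2,m,n)$ if its vertex set can be partitioned into $m$ classes of size $n$ such that any two distinct vertices of the same class have exactly $\lambda_1$ common neighbours and any two vertices of different classes have exactly $\lambda_2$ common neighbours. -}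

module Defs where

open import Data.Nat using (ℕ; _+_; _*_; _∸_)
open import Data.Bool using (Bool)
open import Data.Fin using (Fin; _≟_)
open import Data.Fin.Subset using (Subset; _∩_; ∣_∣)
open import Data.Vec using (tabulate)
open import Data.Product using (_×_)
open import Relation.Nullary.Decidable using (⌊_⌋)
open import Relation.Binary.PropositionalEquality using (_≡_; _≢_)

-- A finite undirected graph without multiple edges, loops allowed,
-- on vertex set Fin v: a symmetric Boolean adjacency relation
-- (adj x x = true means x carries a loop).
record Graph (v : ℕ) : Set where
  field
    adj : Fin v → Fin v → Bool
    sym : ∀ x y → adj x y ≡ adj y x

open Graph public

nbhd : ∀ {v} → Graph v → Fin v → Subset v
nbhd G x = tabulate (adj G x)

-- degree |Γ(x)| (a loop contributes 1)
degree : ∀ {v} → Graph v → Fin v → ℕ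
degree G x = ∣ nbhd G x ∣

common : ∀ {v} → Graph v → Fin v → Fin v → ℕ
common G x y = ∣ nbhd G x ∩ nbhd G y ∣

Regular : ∀ {v} → Graph v → ℕ → Set
Regular G k = ∀ x → degree G x ≡ k

classOf : ∀ {v m} → (Fin v → Fin m) → Fin m → Subset v
classOf cls c = tabulate (λ z → ⌊ cls z ≟ c ⌋)

record IsLDDG {v : ℕ} (G : Graph v) (k λ₁ λ₂ m n : ℕ) : Set where
  field
    regular   : Regular G k
    cls       : Fin v → Fin m
    classSize : ∀ c → ∣ classOf cls c ∣ ≡ n
    sameClass : ∀ x y → x ≢ y → cls x ≡ cls y → common G x y ≡ λ₁
    diffClass : ∀ x y → cls x ≢ cls y → common G x y ≡ λ₂

-- Fix a vertex x and count the pairs (y, z) with z ∈ Γ(x) ∩ Γ(y). Grouped by z, each of the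
-- k neighbours z of x has k neighbours y, giving k². Grouped by y, the vertex y = x gives k,
-- the other n - 1 vertices of its class give λ₁ each and the remaining v - n vertices give
-- λ₂ each. Counting the vertices class by class gives v = mn.
module Submission where

open import Defs
open import Data.Nat using (ℕ; _+_; _*_; _∸_; _<_)
open import Relation.Binary.PropositionalEquality using (_≡_)

open import Data.Bool using (Bool; true; false; _∧_; if_then_else_)
open import Data.Fin using (Fin; zero; suc; _≟_; punchIn; fromℕ<)
open import Data.Fin.Properties using (punchInᵢ≢i)
open import Data.Fin.Subset using (∁; _∩_; ∣_∣)
open import Data.Fin.Subset.Properties using (∩-idem; ∣∁p∣≡n∸∣p∣)
open import Data.Nat using (zero; suc; NonZero; >-nonZero)
open import Data.Nat.Properties
  using (+-*-semiring; +-assoc; +-comm; *-identityˡ; *-identityʳ; *-suc; +-cancelʳ-≡;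
         *-distribʳ-∸; m*n≢0⇒n≢0)
open import Data.Nat.Tactic.RingSolver using (solve-∀)
open import Data.Vec using (tabulate; _∷_)
open import Function using (_∘_)
open import Relation.Binary.PropositionalEquality as ≡
  using (refl; trans; cong; cong₂; subst; _≢_; ≢-sym; module ≡-Reasoning)
open import Relation.Nullary.Decidable using (⌊_⌋; yes; no; ⌊⌋-map′)
open import Relation.Nullary.Negation using (contradiction)

open import Algebra.Properties.Semiring.Sum +-*-semiring
  using (sum; sum-syntax; sum-cong-≗; sum-remove; sum-replicate-zero; ∑-comm;
         *-distribˡ-sum; *-distribʳ-sum)
open ≡-Reasoning

χ : Bool → ℕ
χ true  = 1
χ false = 0

χ-∧ : ∀ a b → χ (a ∧ b) ≡ χ a * χ b
χ-∧ true  b = ≡.sym (*-identityˡ (χ b))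
χ-∧ false b = refl

∑-const : ∀ n c → ∑[ i < n ] c ≡ n * c
∑-const zero    c = refl
∑-const (suc n) c = cong (c +_) (∑-const n c)

∑χ≟≡1 : ∀ {n} (i : Fin n) → ∑[ j < n ] χ ⌊ i ≟ j ⌋ ≡ 1
∑χ≟≡1 {suc n} zero    = cong (1 +_) (sum-replicate-zero n)
∑χ≟≡1 {suc n} (suc i) = trans (sum-cong-≗ (λ j → cong χ (⌊⌋-map′ _ _ (i ≟ j)))) (∑χ≟≡1 i)

∑-differ-at : ∀ {n} {f g : Fin n → ℕ} i → (∀ j → i ≢ j → f j ≡ g j) →
              sum f + g i ≡ sum g + f i
∑-differ-at {suc _} {f} {g} i agree = begin
  sum f + g i                      ≡⟨ cong (_+ g i) (sum-remove f) ⟩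
  f i + sum (f ∘ punchIn i) + g i  ≡⟨ cong (λ r → f i + r + g i) (sum-cong-≗ agree-off-i) ⟩
  f i + sum (g ∘ punchIn i) + g i  ≡⟨ swap-ends (f i) _ (g i) ⟩
  g i + sum (g ∘ punchIn i) + f i  ≡⟨ cong (_+ f i) (sum-remove g) ⟨
  sum g + f i                      ∎
  where
  agree-off-i : ∀ j → f (punchIn i j) ≡ g (punchIn i j)
  agree-off-i j = agree (punchIn i j) (≢-sym (punchInᵢ≢i i j))
  swap-ends : ∀ a r b → a + r + b ≡ b + r + a
  swap-ends = solve-∀

∣tabulate∣≡∑χ : ∀ {n} (p : Fin n → Bool) → ∣ tabulate p ∣ ≡ ∑[ i < n ] χ (p i)
∣tabulate∣≡∑χ {zero}  p = refl
∣tabulate∣≡∑χ {suc n} p with p zero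
... | true  = cong (1 +_) (∣tabulate∣≡∑χ (p ∘ suc))
... | false = ∣tabulate∣≡∑χ (p ∘ suc)

tabulate-∩ : ∀ {n} (p q : Fin n → Bool) → tabulate p ∩ tabulate q ≡ tabulate (λ i → p i ∧ q i)
tabulate-∩ {zero}  p q = refl
tabulate-∩ {suc n} p q = cong (p zero ∧ q zero ∷_) (tabulate-∩ (p ∘ suc) (q ∘ suc))

∑-if : ∀ {n} (p : Fin n → Bool) a b →
       ∑[ i < n ] (if p i then a else b) ≡ ∣ tabulate p ∣ * a + ∣ ∁ (tabulate p) ∣ * b
∑-if {zero}  p a b = refl
∑-if {suc n} p a b with p zero
... | true  = trans (cong (a +_) (∑-if (p ∘ suc) a b)) (≡.sym (+-assoc a _ _))
... | false = trans (cong (b +_) (∑-if (p ∘ suc) a b)) (exchange b (∣ tabulate (p ∘ suc) ∣ * a) _)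
  where
  exchange : ∀ x y z → x + (y + z) ≡ y + (x + z)
  exchange = solve-∀

∑-∣classOf∣ : ∀ {v m} (cls : Fin v → Fin m) → ∑[ c < m ] ∣ classOf cls c ∣ ≡ v
∑-∣classOf∣ {v} {m} cls = begin
  ∑[ c < m ] ∣ classOf cls c ∣           ≡⟨ sum-cong-≗ (λ c → ∣tabulate∣≡∑χ (λ y → ⌊ cls y ≟ c ⌋)) ⟩
  ∑[ c < m ] ∑[ y < v ] χ ⌊ cls y ≟ c ⌋  ≡⟨ ∑-comm (λ c y → χ ⌊ cls y ≟ c ⌋) ⟩
  ∑[ y < v ] ∑[ c < m ] χ ⌊ cls y ≟ c ⌋  ≡⟨ sum-cong-≗ (λ y → ∑χ≟≡1 (cls y)) ⟩
  ∑[ y < v ] 1                           ≡⟨ ∑-const v 1 ⟩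
  v * 1                                  ≡⟨ *-identityʳ v ⟩
  v                                      ∎

square≡m*[m∸1]+m : ∀ m → m * m ≡ m * (m ∸ 1) + m
square≡m*[m∸1]+m zero    = refl
square≡m*[m∸1]+m (suc m) = trans (*-suc (suc m) m) (+-comm (suc m) _)

k*k+a≡n*a+d+k⇒k*[k∸1]≡[n∸1]*a+d : ∀ {k a d} n .{{_ : NonZero n}} →
                                  k * k + a ≡ n * a + d + k → k * (k ∸ 1) ≡ (n ∸ 1) * a + d
k*k+a≡n*a+d+k⇒k*[k∸1]≡[n∸1]*a+d {k} {a} {d} (suc n) eq =
  +-cancelʳ-≡ k _ _ (+-cancelʳ-≡ a _ _ (begin
    k * (k ∸ 1) + k + a  ≡⟨ cong (_+ a) (square≡m*[m∸1]+m k) ⟨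
    k * k + a            ≡⟨ eq ⟩
    a + n * a + d + k    ≡⟨ rotate a (n * a) d k ⟩
    n * a + d + k + a    ∎))
  where
  rotate : ∀ w x y z → w + x + y + z ≡ x + y + z + w
  rotate = solve-∀

module _ {v} (G : Graph v) where

  degree≡∑χ : ∀ x → degree G x ≡ ∑[ z < v ] χ (adj G x z)
  degree≡∑χ x = ∣tabulate∣≡∑χ (adj G x)

  common≡∑χ : ∀ x y → common G x y ≡ ∑[ z < v ] (χ (adj G x z) * χ (adj G z y))
  common≡∑χ x y = begin
    ∣ nbhd G x ∩ nbhd G y ∣                     ≡⟨ cong ∣_∣ (tabulate-∩ (adj G x) (adj G y)) ⟩
    ∣ tabulate (λ z → adj G x z ∧ adj G y z) ∣  ≡⟨ ∣tabulate∣≡∑χ (λ z → adj G x z ∧ adj G y z) ⟩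
    ∑[ z < v ] χ (adj G x z ∧ adj G y z)        ≡⟨ sum-cong-≗ χ-∧-sym ⟩
    ∑[ z < v ] (χ (adj G x z) * χ (adj G z y))  ∎
    where
    χ-∧-sym : ∀ z → χ (adj G x z ∧ adj G y z) ≡ χ (adj G x z) * χ (adj G z y)
    χ-∧-sym z = trans (χ-∧ (adj G x z) (adj G y z)) (cong (λ b → χ (adj G x z) * χ b) (Graph.sym G y z))

  common-self≡degree : ∀ x → common G x x ≡ degree G x
  common-self≡degree x = cong ∣_∣ (∩-idem (nbhd G x))

  ∑-common≡∑-degree : ∀ x → ∑[ y < v ] common G x y ≡ ∑[ z < v ] (χ (adj G x z) * degree G z)
  ∑-common≡∑-degree x = begin
    ∑[ y < v ] common G x y                                ≡⟨ sum-cong-≗ (common≡∑χ x) ⟩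
    ∑[ y < v ] ∑[ z < v ] (χ (adj G x z) * χ (adj G z y))  ≡⟨ ∑-comm (λ y z → χ (adj G x z) * χ (adj G z y)) ⟩
    ∑[ z < v ] ∑[ y < v ] (χ (adj G x z) * χ (adj G z y))  ≡⟨ sum-cong-≗ (λ z → *-distribˡ-sum (χ (adj G x z)) (χ ∘ adj G z)) ⟨
    ∑[ z < v ] (χ (adj G x z) * ∑[ y < v ] χ (adj G z y))  ≡⟨ sum-cong-≗ (λ z → cong (χ (adj G x z) *_) (degree≡∑χ z)) ⟨
    ∑[ z < v ] (χ (adj G x z) * degree G z)                ∎

  ∑-common≡k*k : ∀ {k} → Regular G k → ∀ x → ∑[ y < v ] common G x y ≡ k * k
  ∑-common≡k*k {k} regular x = begin
    ∑[ y < v ] common G x y                  ≡⟨ ∑-common≡∑-degree x ⟩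
    ∑[ z < v ] (χ (adj G x z) * degree G z)  ≡⟨ sum-cong-≗ (cong (χ (adj G x _) *_) ∘ regular) ⟩
    ∑[ z < v ] (χ (adj G x z) * k)           ≡⟨ *-distribʳ-sum k (χ ∘ adj G x) ⟨
    (∑[ z < v ] χ (adj G x z)) * k           ≡⟨ cong (_* k) (trans (≡.sym (degree≡∑χ x)) (regular x)) ⟩
    k * k                                    ∎

module _ {v k λ₁ λ₂ m n} {G : Graph v} (L : IsLDDG G k λ₁ λ₂ m n) where
  open IsLDDG L

  v≡m*n : v ≡ m * n
  v≡m*n = begin
    v                             ≡⟨ ∑-∣classOf∣ cls ⟨
    ∑[ c < m ] ∣ classOf cls c ∣  ≡⟨ sum-cong-≗ classSize ⟩
    ∑[ c < m ] n                  ≡⟨ ∑-const m n ⟩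
    m * n                         ∎

  v∸n≡[m∸1]*n : v ∸ n ≡ (m ∸ 1) * n
  v∸n≡[m∸1]*n = begin
    v ∸ n          ≡⟨ cong₂ _∸_ v≡m*n (≡.sym (*-identityˡ n)) ⟩
    m * n ∸ 1 * n  ≡⟨ *-distribʳ-∸ n m 1 ⟨
    (m ∸ 1) * n    ∎

  λ-of : Fin v → Fin v → ℕ
  λ-of x y = if ⌊ cls y ≟ cls x ⌋ then λ₁ else λ₂

  λ-of-self : ∀ x → λ-of x x ≡ λ₁
  λ-of-self x with cls x ≟ cls x
  ... | yes _   = refl
  ... | no  c≢c = contradiction refl c≢c

  common≡λ-of : ∀ x y → x ≢ y → common G x y ≡ λ-of x y
  common≡λ-of x y x≢y with cls y ≟ cls x
  ... | yes y~x = sameClass x y x≢y (≡.sym y~x)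
  ... | no  y≁x = diffClass x y (y≁x ∘ ≡.sym)

  ∑-λ-of : ∀ x → ∑[ y < v ] λ-of x y ≡ n * λ₁ + (v ∸ n) * λ₂
  ∑-λ-of x = begin
    ∑[ y < v ] λ-of x y            ≡⟨ ∑-if (λ y → ⌊ cls y ≟ cls x ⌋) λ₁ λ₂ ⟩
    ∣ C ∣ * λ₁ + ∣ ∁ C ∣ * λ₂        ≡⟨ cong (λ c → ∣ C ∣ * λ₁ + c * λ₂) (∣∁p∣≡n∸∣p∣ C) ⟩
    ∣ C ∣ * λ₁ + (v ∸ ∣ C ∣) * λ₂    ≡⟨ cong (λ c → c * λ₁ + (v ∸ c) * λ₂) (classSize (cls x)) ⟩
    n * λ₁ + (v ∸ n) * λ₂          ∎
    where C = classOf cls (cls x)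

  -- λ-of x x is a junk value (the axioms say nothing about the pair x, x); adding it to
  -- both sides brings the sum over y into the shape of ∑-differ-at.
  k*k+λ₁≡n*λ₁+[v∸n]*λ₂+k : Fin v → k * k + λ₁ ≡ n * λ₁ + (v ∸ n) * λ₂ + k
  k*k+λ₁≡n*λ₁+[v∸n]*λ₂+k x = begin
    k * k + λ₁                          ≡⟨ cong₂ _+_ (∑-common≡k*k G regular x) (λ-of-self x) ⟨
    ∑[ y < v ] common G x y + λ-of x x  ≡⟨ ∑-differ-at x (common≡λ-of x) ⟩
    ∑[ y < v ] λ-of x y + common G x x  ≡⟨ cong₂ _+_ (∑-λ-of x) (trans (common-self≡degree G x) (regular x)) ⟩
    n * λ₁ + (v ∸ n) * λ₂ + k           ∎

proposition3p1 : (v k λ₁ λ₂ m n : ℕ) (G : Graph v) → 0 < v → IsLDDG G k λ₁ λ₂ m n →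
    k * (k ∸ 1) ≡ (n ∸ 1) * λ₁ + (m ∸ 1) * n * λ₂
proposition3p1 v k λ₁ λ₂ m n G 0<v L = begin
  k * (k ∸ 1)                      ≡⟨ k*k+a≡n*a+d+k⇒k*[k∸1]≡[n∸1]*a+d n (k*k+λ₁≡n*λ₁+[v∸n]*λ₂+k L x) ⟩
  (n ∸ 1) * λ₁ + (v ∸ n) * λ₂      ≡⟨ cong (λ c → (n ∸ 1) * λ₁ + c * λ₂) (v∸n≡[m∸1]*n L) ⟩
  (n ∸ 1) * λ₁ + (m ∸ 1) * n * λ₂  ∎
  where
  x : Fin v
  x = fromℕ< 0<v
  instance
    n≢0 : NonZero n
    n≢0 = m*n≢0⇒n≢0 m {{subst NonZero (v≡m*n L) (>-nonZero 0<v)}}
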